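{- For every integer $n\ge3$, $\gamma_{[2]R}(C_4\square P_n)\le 3n$.
   Context: $C_4$ is the cycle on 4 vertices, $P_n$ the path on $n$ vertices, and $\square$ the Cartesian product. For a labeling $f:V(G)\to\{0,1,2,3\}$, let $AN(v)=\{u\in N(v): f(u)>0\}$. The labeling $f$ is a $[2]$-Roman dominating function if every vertex $v$ with $f(v)<2$ satisfies $f(N[v])\ge 2+|AN(v)|$, where $N[v]=N(v)\cup\{v\}$ and $f(X)=\sum_{x\in X}f(x)$. $\gamma_{[2]R}(G)$ is the minimum of $\sum_v f(v)$ over all $[2]$-Roman dominating functions $f$ on $G$. -}

module Defs where

open import Data.Nat using (ℕ; zero; suc; _+_; _≤_; _<_; _≡ᵇ_; _%_)
open import Data.Bool using (Bool; true; false; _∧_; _∨_; if_then_else_)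
open import Data.Fin using (Fin; toℕ)
open import Data.List using (List; filter; map; length; cartesianProduct; allFin)
open import Data.Nat.ListAction using (sum)
open import Data.Product using (_×_; _,_; Σ; ∃)
open import Relation.Nullary.Decidable using (⌊_⌋)
open import Relation.Unary using (Pred)
open import Data.Bool using (T)

-- A finite simple graph: a vertex type, a duplicate-free enumeration of all
-- vertices, decidable equality (as Bool) and a Boolean adjacency relation.
record Graph : Set₁ where
  field
    V     : Set
    verts : List V
    eqV   : V → V → Bool
    adj   : V → V → Bool

open Graph public

C4 : Graph
C4 = record
  { V = Fin 4
  ; verts = allFin 4
  ; eqV = λ i j → toℕ i ≡ᵇ toℕ j
  ; adj = λ i j → (((toℕ i + 1) % 4) ≡ᵇ toℕ j) ∨ (((toℕ j + 1) % 4) ≡ᵇ toℕ i)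
  }

P : ℕ → Graph
P n = record
  { V = Fin n
  ; verts = allFin n
  ; eqV = λ i j → toℕ i ≡ᵇ toℕ j
  ; adj = λ i j → (suc (toℕ i) ≡ᵇ toℕ j) ∨ (suc (toℕ j) ≡ᵇ toℕ i)
  }

_□_ : Graph → Graph → Graph
G □ H = record
  { V = V G × V H
  ; verts = cartesianProduct (verts G) (verts H)
  ; eqV = λ { (g , h) (g' , h') → eqV G g g' ∧ eqV H h h' }
  ; adj = λ { (g , h) (g' , h') → (eqV G g g' ∧ adj H h h') ∨ (eqV H h h' ∧ adj G g g') }
  }

N : (G : Graph) → V G → List (V G)
N G v = filter (λ u → T? (adj G v u)) (verts G)
  where
  open import Data.Bool.Properties using (T?)

wsum : {A : Set} → (A → ℕ) → List A → ℕ
wsum f xs = sum (map f xs)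

AN : (G : Graph) → (V G → ℕ) → V G → List (V G)
AN G f v = filter (λ u → 0 <? f u) (N G v)
  where
  open import Data.Nat using (_<?_)

-- f is a labeling V → {0,1,2,3} (values ≤ 3) and a [2]-Roman dominating function:
-- every v with f(v) < 2 satisfies f(N[v]) ≥ 2 + |AN(v)|, where f(N[v]) = f(v) + f(N(v)).
Is2RDF : (G : Graph) → (V G → ℕ) → Set
Is2RDF G f =
  ((v : V G) → f v ≤ 3) ×
  ((v : V G) → f v < 2 → 2 + length (AN G f v) ≤ f v + wsum f (N G v))

weight : (G : Graph) → (V G → ℕ) → ℕ
weight G f = wsum f (verts G)

-- γ_{[2]R}(G) ≤ k  :⇔  some [2]-RDF on G has weight ≤ k  (γ is the minimum weight).
γ[2]R≤ : Graph → ℕ → Set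
γ[2]R≤ G k = Σ (V G → ℕ) (λ f → Is2RDF G f × weight G f ≤ k)

-- Put weight 3 on a dominating set D and 0 elsewhere: a vertex outside D has at least one
-- labelled neighbour, and if it has k ≥ 1 of them its closed neighbourhood weighs 3k ≥ 2 + k,
-- so this labeling is a [2]-Roman dominating function of weight 3|D|.  In C₄ □ Pₙ the set
-- consisting of cycle vertex 0 in the even layers and cycle vertex 2 in the odd layers
-- dominates: vertices 1 and 3 see the chosen vertex of their own layer, and vertices 0 and 2
-- see their copy in an adjacent layer of the other parity.  It has one vertex per layer.
module Submission where

open import Defs
open import Data.Nat using (ℕ; zero; suc; _+_; _*_; _≤_; _<_; _<?_; s≤s; z≤n)
open import Data.Nat.Properties
  using (≤-refl; ≤-trans; ≤-reflexive; +-comm; *-suc; *-zeroʳ; +-monoˡ-≤; *-monoʳ-≤; m≤n+m;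
         ≡⇒≡ᵇ; +-commutativeSemigroup)
open import Data.Nat.ListAction using (sum)
open import Data.Nat.ListAction.Properties using (sum-++)
open import Data.Bool using (Bool; true; false; not; if_then_else_; T)
open import Data.Bool.Properties using (T?; not-involutive; T-∧; T-∨)
import Data.Fin as Fin
open Fin using (Fin; toℕ; fromℕ<; inject₁)
open import Data.Fin.Patterns using (0F; 1F; 2F; 3F)
open import Data.Fin.Properties using (toℕ-fromℕ<; toℕ-inject₁)
open import Data.List using (List; []; _∷_; _++_; filter; map; length; allFin; cartesianProduct)
open import Data.List.Properties using (map-++; map-∘; map-cong; length-tabulate)
open import Data.List.Membership.Propositional using (_∈_)
open import Data.List.Membership.Propositional.Properties
  using (∈-filter⁺; ∈-allFin; ∈-cartesianProduct⁺)
open import Data.List.Relation.Unary.Any using (here; there)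
open import Data.Product using (_×_; _,_; ∃-syntax)
open import Data.Sum using (inj₁; inj₂)
open import Data.Empty using (⊥-elim)
open import Relation.Nullary using (yes; no)
open import Function.Bundles using (Equivalence)
open import Relation.Binary.PropositionalEquality using (_≡_; refl; sym; trans; cong; cong₂; module ≡-Reasoning)
open import Algebra.Properties.CommutativeSemigroup +-commutativeSemigroup using (interchange)

private
  variable
    A B : Set

wsum-++ : ∀ (f : A → ℕ) xs ys → wsum f (xs ++ ys) ≡ wsum f xs + wsum f ys
wsum-++ f xs ys = trans (cong sum (map-++ f xs ys)) (sum-++ (map f xs) (map f ys))

wsum-map : ∀ (f : B → ℕ) (g : A → B) xs → wsum f (map g xs) ≡ wsum (λ x → f (g x)) xs
wsum-map f g xs = cong sum (sym (map-∘ xs))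

wsum-cong : ∀ {f g : A → ℕ} → (∀ x → f x ≡ g x) → ∀ xs → wsum f xs ≡ wsum g xs
wsum-cong f≗g xs = cong sum (map-cong f≗g xs)

wsum-+ : ∀ (f g : A → ℕ) xs → wsum (λ x → f x + g x) xs ≡ wsum f xs + wsum g xs
wsum-+ f g []       = refl
wsum-+ f g (x ∷ xs) =
  trans (cong (f x + g x +_) (wsum-+ f g xs)) (interchange (f x) (g x) (wsum f xs) (wsum g xs))

wsum-const : ∀ c (xs : List A) → wsum (λ _ → c) xs ≡ c * length xs
wsum-const c []       = sym (*-zeroʳ c)
wsum-const c (x ∷ xs) = trans (cong (c +_) (wsum-const c xs)) (sym (*-suc c (length xs)))

wsum-cartesianProduct : ∀ (f : A × B → ℕ) xs ys →
  wsum f (cartesianProduct xs ys) ≡ wsum (λ x → wsum (λ y → f (x , y)) ys) xs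
wsum-cartesianProduct f []       ys = refl
wsum-cartesianProduct f (x ∷ xs) ys =
  begin
    wsum f (map (x ,_) ys ++ cartesianProduct xs ys)
      ≡⟨ wsum-++ f (map (x ,_) ys) (cartesianProduct xs ys) ⟩
    wsum f (map (x ,_) ys) + wsum f (cartesianProduct xs ys)
      ≡⟨ cong₂ _+_ (wsum-map f (x ,_) ys) (wsum-cartesianProduct f xs ys) ⟩
    wsum (λ y → f (x , y)) ys + wsum (λ x′ → wsum (λ y → f (x′ , y)) ys) xs
      ∎
  where open ≡-Reasoning

wsum-comm : ∀ (f : A → B → ℕ) xs ys →
  wsum (λ x → wsum (f x) ys) xs ≡ wsum (λ y → wsum (λ x → f x y) xs) ys
wsum-comm f []       ys = sym (wsum-const 0 ys)
wsum-comm f (x ∷ xs) ys =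
  trans (cong (wsum (f x) ys +_) (wsum-comm f xs ys))
        (sym (wsum-+ (f x) (λ y → wsum (λ x′ → f x′ y) xs) ys))

tripleIndicator : (A → Bool) → A → ℕ
tripleIndicator D x = if D x then 3 else 0

wsum-tripleIndicator : ∀ (D : A → Bool) xs →
  wsum (tripleIndicator D) xs ≡ 3 * length (filter (λ u → 0 <? tripleIndicator D u) xs)
wsum-tripleIndicator D []       = refl
wsum-tripleIndicator D (x ∷ xs) with D x
... | true  = trans (cong (3 +_) (wsum-tripleIndicator D xs)) (sym (*-suc 3 _))
... | false = wsum-tripleIndicator D xs

Dominates : (G : Graph) → (V G → Bool) → Set
Dominates G D = ∀ v → D v ≡ false → ∃[ u ] T (adj G v u) × D u ≡ true

2+k≤3*k : ∀ {k} → 1 ≤ k → 2 + k ≤ 3 * k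
2+k≤3*k {k} 1≤k = ≤-trans (+-monoˡ-≤ k (*-monoʳ-≤ 2 1≤k)) (≤-reflexive (+-comm (2 * k) k))

length-pos : ∀ {x : A} {xs} → x ∈ xs → 1 ≤ length xs
length-pos (here _)  = s≤s z≤n
length-pos (there _) = s≤s z≤n

module _ (D : A → Bool) where

  tripleIndicator≤3 : ∀ x → tripleIndicator D x ≤ 3
  tripleIndicator≤3 x with D x
  ... | true  = ≤-refl
  ... | false = z≤n

  tripleIndicator<2⇒∉ : ∀ {x} → tripleIndicator D x < 2 → D x ≡ false
  tripleIndicator<2⇒∉ {x} lt with D x
  tripleIndicator<2⇒∉ (s≤s (s≤s ())) | true
  ... | false = refl

  ∈⇒tripleIndicator>0 : ∀ {x} → D x ≡ true → 0 < tripleIndicator D x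
  ∈⇒tripleIndicator>0 {x} x∈D with D x
  ... | true = s≤s z≤n

  2+positive≤wsum-tripleIndicator : ∀ {u xs} → u ∈ xs → D u ≡ true →
    2 + length (filter (λ x → 0 <? tripleIndicator D x) xs) ≤ wsum (tripleIndicator D) xs
  2+positive≤wsum-tripleIndicator {u} {xs} u∈xs u∈D =
    ≤-trans (2+k≤3*k (length-pos u∈positive)) (≤-reflexive (sym (wsum-tripleIndicator D xs)))
    where
    u∈positive : u ∈ filter (λ x → 0 <? tripleIndicator D x) xs
    u∈positive = ∈-filter⁺ (λ x → 0 <? tripleIndicator D x) u∈xs (∈⇒tripleIndicator>0 u∈D)

tripleIndicator-is2RDF : (G : Graph) → (∀ v → v ∈ verts G) →
  ∀ {D} → Dominates G D → Is2RDF G (tripleIndicator D)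
tripleIndicator-is2RDF G complete {D} dom = tripleIndicator≤3 D , condition
  where
  condition : ∀ v → tripleIndicator D v < 2 →
    2 + length (AN G (tripleIndicator D) v) ≤ tripleIndicator D v + wsum (tripleIndicator D) (N G v)
  condition v lt with dom v (tripleIndicator<2⇒∉ D lt)
  ... | u , v~u , u∈D =
    ≤-trans (2+positive≤wsum-tripleIndicator D (∈-filter⁺ (λ w → T? (adj G v w)) (complete u) v~u) u∈D)
            (m≤n+m _ (tripleIndicator D v))

□-verts-complete : ∀ G H → (∀ g → g ∈ verts G) → (∀ h → h ∈ verts H) →
  ∀ v → v ∈ verts (G □ H)
□-verts-complete G H completeG completeH (g , h) = ∈-cartesianProduct⁺ (completeG g) (completeH h)

□-adjˡ : ∀ G H g g′ h → T (eqV H h h) → T (adj G g g′) → T (adj (G □ H) (g , h) (g′ , h))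
□-adjˡ G H g g′ h h≈h g~g′ = Equivalence.from T-∨ (inj₂ (Equivalence.from T-∧ (h≈h , g~g′)))

□-adjʳ : ∀ G H g h h′ → T (eqV G g g) → T (adj H h h′) → T (adj (G □ H) (g , h) (g , h′))
□-adjʳ G H g h h′ g≈g h~h′ = Equivalence.from T-∨ (inj₁ (Equivalence.from T-∧ (g≈g , h~h′)))

P-eqV-refl : ∀ {n} (j : Fin n) → T (eqV (P n) j j)
P-eqV-refl j = ≡⇒≡ᵇ (toℕ j) (toℕ j) refl

P-adj-suc : ∀ {n} {j k : Fin n} → suc (toℕ j) ≡ toℕ k → T (adj (P n) j k)
P-adj-suc {j = j} {k} eq = Equivalence.from T-∨ (inj₁ (≡⇒≡ᵇ (suc (toℕ j)) (toℕ k) eq))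

P-adj-pred : ∀ {n} {j k : Fin n} → suc (toℕ k) ≡ toℕ j → T (adj (P n) j k)
P-adj-pred {j = j} {k} eq = Equivalence.from T-∨ (inj₂ (≡⇒≡ᵇ (suc (toℕ k)) (toℕ j) eq))

even : ℕ → Bool
even zero    = true
even (suc m) = not (even m)

P-neighbour-of-other-parity : ∀ {n} → 2 ≤ n → (j : Fin n) →
  ∃[ k ] T (adj (P n) j k) × even (toℕ k) ≡ not (even (toℕ j))
P-neighbour-of-other-parity {n} n≥2 j with suc (toℕ j) <? n
... | yes j+1<n =
  fromℕ< j+1<n , P-adj-suc (sym (toℕ-fromℕ< j+1<n)) , cong even (toℕ-fromℕ< j+1<n)
P-neighbour-of-other-parity n≥2 0F | no 1≮n = ⊥-elim (1≮n n≥2)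
P-neighbour-of-other-parity n≥2 (Fin.suc j) | no _ =
  inject₁ j , P-adj-pred (cong suc (toℕ-inject₁ j)) ,
  trans (cong even (toℕ-inject₁ j)) (sym (not-involutive (even (toℕ j))))

ladderLayer : Bool → Fin 4 → Bool
ladderLayer b 0F = b
ladderLayer b 2F = not b
ladderLayer _ _  = false

ladder : ∀ {n} → V (C4 □ P n) → Bool
ladder (i , j) = ladderLayer (even (toℕ j)) i

layer-adj : ∀ {n} (i : Fin 4) (j k : Fin n) → T (adj (P n) j k) → T (adj (C4 □ P n) (i , j) (i , k))
layer-adj i j k = □-adjʳ C4 (P _) i j k (P-eqV-refl i)

cycle-adj : ∀ {n} (i i′ : Fin 4) (j : Fin n) → T (adj C4 i i′) → T (adj (C4 □ P n) (i , j) (i′ , j))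
cycle-adj i i′ j = □-adjˡ C4 (P _) i i′ j (P-eqV-refl j)

ladder-dominates : ∀ {n} → 2 ≤ n → Dominates (C4 □ P n) ladder
ladder-dominates n≥2 (i , j) _ with even (toℕ j) in parity | P-neighbour-of-other-parity n≥2 j
ladder-dominates _ (0F , j) () | true  | _
ladder-dominates _ (0F , j) _  | false | k , j~k , flip =
  (0F , k) , layer-adj 0F j k j~k , flip
ladder-dominates _ (2F , j) _  | true  | k , j~k , flip =
  (2F , k) , layer-adj 2F j k j~k , cong not flip
ladder-dominates _ (2F , j) () | false | _
ladder-dominates _ (1F , j) _  | true  | _ = (0F , j) , cycle-adj 1F 0F j _ , parity
ladder-dominates _ (1F , j) _  | false | _ = (2F , j) , cycle-adj 1F 2F j _ , cong not parity
ladder-dominates _ (3F , j) _  | true  | _ = (0F , j) , cycle-adj 3F 0F j _ , parity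
ladder-dominates _ (3F , j) _  | false | _ = (2F , j) , cycle-adj 3F 2F j _ , cong not parity

ladderLayer-weight : ∀ b → wsum (λ i → tripleIndicator (ladderLayer b) i) (allFin 4) ≡ 3
ladderLayer-weight true  = refl
ladderLayer-weight false = refl

weight-ladder : ∀ n → weight (C4 □ P n) (tripleIndicator ladder) ≡ 3 * n
weight-ladder n = begin
  wsum f (cartesianProduct (allFin 4) (allFin n))
    ≡⟨ wsum-cartesianProduct f (allFin 4) (allFin n) ⟩
  wsum (λ i → wsum (λ j → f (i , j)) (allFin n)) (allFin 4)
    ≡⟨ wsum-comm (λ i j → f (i , j)) (allFin 4) (allFin n) ⟩
  wsum (λ j → wsum (λ i → f (i , j)) (allFin 4)) (allFin n)
    ≡⟨ wsum-cong (λ j → ladderLayer-weight (even (toℕ j))) (allFin n) ⟩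
  wsum (λ _ → 3) (allFin n)
    ≡⟨ wsum-const 3 (allFin n) ⟩
  3 * length (allFin n)
    ≡⟨ cong (3 *_) (length-tabulate {n = n} (λ j → j)) ⟩
  3 * n ∎
  where
  open ≡-Reasoning
  f : Fin 4 × Fin n → ℕ
  f = tripleIndicator ladder

mainTheorem16 : (n : ℕ) → 3 ≤ n → γ[2]R≤ (C4 □ P n) (3 * n)
mainTheorem16 n n≥3 =
  tripleIndicator ladder ,
  tripleIndicator-is2RDF (C4 □ P n) (□-verts-complete C4 (P n) ∈-allFin ∈-allFin)
                         (ladder-dominates n≥2) ,
  ≤-reflexive (weight-ladder n)
  where
  n≥2 : 2 ≤ n
  n≥2 = ≤-trans (s≤s (s≤s z≤n)) n≥3
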